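{- Let $f\in\mathbb{Q}[x]$ be a square-free polynomial of degree $5$ or $6$. Then there exist symmetric matrices $M_1,M_2,M_3\in\mathbb{Q}^{3\times 3}$ such that $$f=\det(M_1+xM_2+x^2M_3).$$ -}

module Defs where

open import Data.Nat using (ℕ; zero; suc; _<_; _≤_)
open import Data.Rational using (ℚ; 0ℚ) renaming (_+_ to _+ℚ_; _*_ to _*ℚ_; -_ to -ℚ_)
open import Data.List using (List; []; _∷_; map)
open import Data.Fin using (Fin; zero; suc)
open import Data.Product using (Σ; _×_; ∃)
open import Relation.Binary.PropositionalEquality using (_≡_; _≢_)
open import Relation.Nullary using (¬_)

-- Polynomials in ℚ[x] as coefficient lists, lowest degree first.
-- Trailing zeros are allowed; polynomials are compared coefficientwise.
Poly : Set
Poly = List ℚ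

coeff : Poly → ℕ → ℚ
coeff []      _       = 0ℚ
coeff (a ∷ p) zero    = a
coeff (a ∷ p) (suc i) = coeff p i

_≈ₚ_ : Poly → Poly → Set
p ≈ₚ q = ∀ i → coeff p i ≡ coeff q i

infix 4 _≈ₚ_
infixl 6 _+ₚ_ _-ₚ_
infixl 7 _*ₚ_

_+ₚ_ : Poly → Poly → Poly
[]      +ₚ q       = q
(a ∷ p) +ₚ []      = a ∷ p
(a ∷ p) +ₚ (b ∷ q) = (a +ℚ b) ∷ (p +ₚ q)

negₚ : Poly → Poly
negₚ = map -ℚ_

_-ₚ_ : Poly → Poly → Poly
p -ₚ q = p +ₚ negₚ q

_*ₚ_ : Poly → Poly → Poly
[]      *ₚ q = []
(a ∷ p) *ₚ q = map (a *ℚ_) q +ₚ (0ℚ ∷ (p *ₚ q))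

HasDegree : Poly → ℕ → Set
HasDegree f d = (coeff f d ≢ 0ℚ) × (∀ i → d < i → coeff f i ≡ 0ℚ)

NonConstant : Poly → Set
NonConstant g = ∃ λ i → (1 ≤ i) × (coeff g i ≢ 0ℚ)

_∣ₚ_ : Poly → Poly → Set
g ∣ₚ f = ∃ λ h → f ≈ₚ g *ₚ h

-- square-free: not divisible by the square of any non-constant polynomial
-- (the non-units of ℚ[x] dividing a nonzero f are exactly the non-constant ones)
SquareFree : Poly → Set
SquareFree f = ∀ g → NonConstant g → ¬ ((g *ₚ g) ∣ₚ f)

Mat3 : Set
Mat3 = Fin 3 → Fin 3 → ℚ

Symmetric : Mat3 → Set
Symmetric M = ∀ i j → M i j ≡ M j i

PMat3 : Set
PMat3 = Fin 3 → Fin 3 → Poly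

pencil : Mat3 → Mat3 → Mat3 → PMat3
pencil M₁ M₂ M₃ i j = M₁ i j ∷ M₂ i j ∷ M₃ i j ∷ []

private
  z o t : Fin 3
  z = zero
  o = suc zero
  t = suc (suc zero)

det3 : PMat3 → Poly
det3 A =
      A z z *ₚ (A o o *ₚ A t t -ₚ A o t *ₚ A t o)
  -ₚ A z o *ₚ (A o z *ₚ A t t -ₚ A o t *ₚ A t z)
  +ₚ A z t *ₚ (A o z *ₚ A t o -ₚ A o o *ₚ A t z)

-- Every polynomial a₀ + a₁x + ⋯ + a₆x⁶ of degree at most 6, square-free or not, is the
-- determinant of the symmetric quadratic pencil
--
--   ( 0    1                   x²                )
--   ( 1    -(a₄ + a₅x + a₆x²)   (a₃/2)x           )
--   ( x²   (a₃/2)x              -(a₀ + a₁x + a₂x²) )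
--
-- since expanding along the first row gives (a₀ + a₁x + a₂x²) + a₃x³ + x⁴(a₄ + a₅x + a₆x²).
module Submission where

open import Defs
open import Data.Fin using (Fin; zero; suc; #_)
open import Data.List using (List; applyUpTo; map; _∷_; [])
open import Data.Nat using (ℕ; zero; suc; _<_; _≤_; s≤s; _≤?_)
open import Data.Nat.Properties using (≤-<-trans; ≰⇒>; n≤1+n)
open import Data.Product using (∃; _×_; _,_)
open import Data.Rational using (ℚ; 0ℚ; 1ℚ; ½; _*_; -_)
open import Data.Rational.Properties using (+-*-commutativeRing; _≟_)
open import Data.Sum using (_⊎_; inj₁; inj₂)
open import Data.Vec using (Vec; _∷_; [])
open import Level using (0ℓ)
open import Relation.Binary.PropositionalEquality using (_≡_; refl; sym; trans)
open import Relation.Nullary using (yes; no)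
open import Relation.Nullary.Decidable using (dec⇒maybe)
import Tactic.RingSolver.Core.AlmostCommutativeRing as ACR

ℚ-ring : ACR.AlmostCommutativeRing 0ℓ 0ℓ
ℚ-ring = ACR.fromCommutativeRing +-*-commutativeRing (λ x → dec⇒maybe (0ℚ ≟ x))

open import Tactic.RingSolver.NonReflective ℚ-ring using (Expr; Κ; Ι; _⊕_; _⊗_; ⊝_; module Ops)

DegreeAtMost : Poly → ℕ → Set
DegreeAtMost f d = ∀ i → d < i → coeff f i ≡ 0ℚ

DegreeAtMost-mono : ∀ {f m n} → m ≤ n → DegreeAtMost f m → DegreeAtMost f n
DegreeAtMost-mono m≤n deg i n<i = deg i (≤-<-trans m≤n n<i)

degree5or6⇒DegreeAtMost6 : ∀ f → HasDegree f 5 ⊎ HasDegree f 6 → DegreeAtMost f 6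
degree5or6⇒DegreeAtMost6 f (inj₁ (_ , degree≤5)) = DegreeAtMost-mono {f} (n≤1+n 5) degree≤5
degree5or6⇒DegreeAtMost6 f (inj₂ (_ , degree≤6)) = degree≤6

truncate : ℕ → Poly → Poly
truncate n f = applyUpTo (coeff f) n

coeff-applyUpTo-< : ∀ g {n i} → i < n → coeff (applyUpTo g n) i ≡ g i
coeff-applyUpTo-< g {suc n} {zero}  _         = refl
coeff-applyUpTo-< g {suc n} {suc i} (s≤s i<n) = coeff-applyUpTo-< (λ j → g (suc j)) i<n

coeff-applyUpTo-≥ : ∀ g {n i} → n ≤ i → coeff (applyUpTo g n) i ≡ 0ℚ
coeff-applyUpTo-≥ g {zero}  _         = refl
coeff-applyUpTo-≥ g {suc n} (s≤s n≤i) = coeff-applyUpTo-≥ (λ j → g (suc j)) n≤i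

≈ₚ-truncate : ∀ {f} d → DegreeAtMost f d → f ≈ₚ truncate (suc d) f
≈ₚ-truncate {f} d deg i with i ≤? d
... | yes i≤d = sym (coeff-applyUpTo-< (coeff f) (s≤s i≤d))
... | no  i≰d = trans (deg i (≰⇒> i≰d)) (sym (coeff-applyUpTo-≥ (coeff f) (≰⇒> i≰d)))

symmetric3 : {A : Set} (a b c d e g : A) → Fin 3 → Fin 3 → A
symmetric3 a b c d e g zero             zero             = a
symmetric3 a b c d e g zero             (suc zero)       = b
symmetric3 a b c d e g zero             (suc (suc zero)) = c
symmetric3 a b c d e g (suc zero)       zero             = b
symmetric3 a b c d e g (suc zero)       (suc zero)       = d
symmetric3 a b c d e g (suc zero)       (suc (suc zero)) = e
symmetric3 a b c d e g (suc (suc zero)) zero             = c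
symmetric3 a b c d e g (suc (suc zero)) (suc zero)       = e
symmetric3 a b c d e g (suc (suc zero)) (suc (suc zero)) = g

symmetric3-symmetric : ∀ a b c d e g → Symmetric (symmetric3 a b c d e g)
symmetric3-symmetric a b c d e g zero             zero             = refl
symmetric3-symmetric a b c d e g zero             (suc zero)       = refl
symmetric3-symmetric a b c d e g zero             (suc (suc zero)) = refl
symmetric3-symmetric a b c d e g (suc zero)       zero             = refl
symmetric3-symmetric a b c d e g (suc zero)       (suc zero)       = refl
symmetric3-symmetric a b c d e g (suc zero)       (suc (suc zero)) = refl
symmetric3-symmetric a b c d e g (suc (suc zero)) zero             = refl
symmetric3-symmetric a b c d e g (suc (suc zero)) (suc zero)       = refl
symmetric3-symmetric a b c d e g (suc (suc zero)) (suc (suc zero)) = refl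

-- Copies of coeff, _+ₚ_, _-ₚ_, _*ₚ_ and det3 for polynomials whose coefficients are ring
-- expressions in seven unknowns, and the pencil of sextic₀, sextic₁, sextic₂ (below) with each
-- a k replaced by the unknown Ι (# k).  The solver's semantics Ops.⟦_⟧ commutes with these
-- clause by clause, so the denotation of a symbolic coefficient is definitionally the rational
-- one and the ring solver can decide it (proof by reflection).
SymPoly : Set
SymPoly = List (Expr ℚ 7)

coeffˢ : SymPoly → ℕ → Expr ℚ 7
coeffˢ []      _       = Κ 0ℚ
coeffˢ (a ∷ p) zero    = a
coeffˢ (a ∷ p) (suc i) = coeffˢ p i

infixl 6 _+ˢ_ _-ˢ_
infixl 7 _*ˢ_

_+ˢ_ : SymPoly → SymPoly → SymPoly
[]      +ˢ q       = q
(a ∷ p) +ˢ []      = a ∷ p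
(a ∷ p) +ˢ (b ∷ q) = (a ⊕ b) ∷ (p +ˢ q)

_-ˢ_ : SymPoly → SymPoly → SymPoly
p -ˢ q = p +ˢ map ⊝_ q

_*ˢ_ : SymPoly → SymPoly → SymPoly
[]      *ˢ q = []
(a ∷ p) *ˢ q = map (a ⊗_) q +ˢ (Κ 0ℚ ∷ (p *ˢ q))

det3ˢ : (Fin 3 → Fin 3 → SymPoly) → SymPoly
det3ˢ A =
      A z z *ˢ (A o o *ˢ A t t -ˢ A o t *ˢ A t o)
  -ˢ A z o *ˢ (A o z *ˢ A t t -ˢ A o t *ˢ A t z)
  +ˢ A z t *ˢ (A o z *ˢ A t o -ˢ A o o *ˢ A t z)
  where
  z o t : Fin 3
  z = zero
  o = suc zero
  t = suc (suc zero)

sexticPencilˢ : Fin 3 → Fin 3 → SymPoly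
sexticPencilˢ i j =
    symmetric3 (Κ 0ℚ) (Κ 1ℚ) (Κ 0ℚ) (⊝ Ι (# 4)) (Κ 0ℚ)          (⊝ Ι (# 0)) i j
  ∷ symmetric3 (Κ 0ℚ) (Κ 0ℚ) (Κ 0ℚ) (⊝ Ι (# 5)) (Κ ½ ⊗ Ι (# 3)) (⊝ Ι (# 1)) i j
  ∷ symmetric3 (Κ 0ℚ) (Κ 0ℚ) (Κ 1ℚ) (⊝ Ι (# 6)) (Κ 0ℚ)          (⊝ Ι (# 2)) i j
  ∷ []

sexticDetˢ : SymPoly
sexticDetˢ = det3ˢ sexticPencilˢ

module _ (a : ℕ → ℚ) where

  sextic₀ sextic₁ sextic₂ : Mat3
  sextic₀ = symmetric3 0ℚ 1ℚ 0ℚ (- a 4) 0ℚ         (- a 0)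
  sextic₁ = symmetric3 0ℚ 0ℚ 0ℚ (- a 5) (½ * a 3) (- a 1)
  sextic₂ = symmetric3 0ℚ 0ℚ 1ℚ (- a 6) 0ℚ         (- a 2)

  private
    ρ : Vec ℚ 7
    ρ = a 0 ∷ a 1 ∷ a 2 ∷ a 3 ∷ a 4 ∷ a 5 ∷ a 6 ∷ []

  det3-sexticPencil : det3 (pencil sextic₀ sextic₁ sextic₂) ≈ₚ applyUpTo a 7
  det3-sexticPencil 0 = Ops.prove ρ (coeffˢ sexticDetˢ 0) (Ι (# 0)) refl
  det3-sexticPencil 1 = Ops.prove ρ (coeffˢ sexticDetˢ 1) (Ι (# 1)) refl
  det3-sexticPencil 2 = Ops.prove ρ (coeffˢ sexticDetˢ 2) (Ι (# 2)) refl
  det3-sexticPencil 3 = Ops.prove ρ (coeffˢ sexticDetˢ 3) (Ι (# 3)) refl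
  det3-sexticPencil 4 = Ops.prove ρ (coeffˢ sexticDetˢ 4) (Ι (# 4)) refl
  det3-sexticPencil 5 = Ops.prove ρ (coeffˢ sexticDetˢ 5) (Ι (# 5)) refl
  det3-sexticPencil 6 = Ops.prove ρ (coeffˢ sexticDetˢ 6) (Ι (# 6)) refl
  det3-sexticPencil (suc (suc (suc (suc (suc (suc (suc i))))))) = refl

proposition1p3 : (f : Poly) → SquareFree f → (HasDegree f 5 ⊎ HasDegree f 6) →
    ∃ λ M₁ → ∃ λ M₂ → ∃ λ M₃ →
      Symmetric M₁ × Symmetric M₂ × Symmetric M₃ × (f ≈ₚ det3 (pencil M₁ M₂ M₃))
proposition1p3 f _ deg =
  sextic₀ (coeff f) , sextic₁ (coeff f) , sextic₂ (coeff f) ,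
  symmetric3-symmetric _ _ _ _ _ _ , symmetric3-symmetric _ _ _ _ _ _ ,
  symmetric3-symmetric _ _ _ _ _ _ ,
  λ i → trans (≈ₚ-truncate {f} 6 (degree5or6⇒DegreeAtMost6 f deg) i)
              (sym (det3-sexticPencil (coeff f) i))
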